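{- Let $L=C_0]_0^{x_1}C_1]_0^{x_2}\cdots]_0^{x_n}C_n$ be a lower dismantlable lattice, where the $C_i$ are finite chains. Then for nonzero elements $a,b\in L$: (i) $a\wedge b=0$ if and only if $a$ and $b$ are incomparable; (ii) if $a\in C_i$ (for some $i\in\{1,\dots,n\}$) and $b\notin C_i$, then $a\le b$ if and only if $x_i\le b$; (iii) if $(0,1)$ is an adjunct pair, i.e. $x_i=1$ for some $i\in\{1,\dots,n\}$, then $|V(G_{\{0\}}(L))|=|L|-2$.
   Context: Adjunct operation: for disjoint finite lattices $L_1,L_2$ and $a<b$ in $L_1$ with $b$ not covering $a$, $L_1]_a^bL_2$ is the set $L_1\cup L_2$ ordered by: $x\le y$ iff ($x,y\in L_1$, $x\le y$ in $L_1$) or ($x,y\in L_2$, $x\le y$ in $L_2$) or ($x\in L_1$, $y\in L_2$, $x\le a$) or ($x\in L_2$, $y\in L_1$, $b\le y$); $(a,b)$ is called an adjunct pair. The expression $C_0]_0^{x_1}C_1]_0^{x_2}\cdots]_0^{x_n}C_n$ means successive adjunction, each $C_i$ being adjoined with adjunct pair $(0,x_i)$ to the lattice built so far; such a lattice is lower dismantlable (a dismantlable lattice all of whose adjunct pairs have the form $(0,b)$). The zero-divisor graph $G_{\{0\}}(L)$ has vertex set $\{x\in L\setminus\{0\}: x\wedge y=0\text{ for some }y\in L\setminus\{0\}\}$, distinct vertices $x,y$ adjacent iff $x\wedge y=0$. -}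

module Defs where

open import Data.Nat using (ℕ; zero; suc; _≤_; _≟_)
open import Data.Fin using (Fin; toℕ)
import Data.Fin as F
open import Data.Sum using (_⊎_; inj₁; inj₂)
open import Data.Product using (Σ; ∃; _×_; _,_)
open import Data.Unit using (⊤)
open import Data.Empty using (⊥)
open import Relation.Nullary using (¬_; yes; no)
open import Relation.Binary.PropositionalEquality using (_≡_)
open import Function.Definitions using (Injective)

-- A lower dismantlable lattice  C_0 ]_0^{x_1} C_1 ]_0^{x_2} ... ]_0^{x_n} C_n
-- is described by the sequence of its construction steps.
--   base m       : the chain C_0 with  suc m  elements (Fin (suc m), usual order)
--   adj B x m    : (lattice of B) ]_0^x C, where C is a chain with suc m elements
--                  and x is an element of the lattice built so far.
-- (Induction-recursion: the type of x depends on the earlier stages.)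
mutual
  data Build : Set where
    base : ℕ → Build
    adj  : (B : Build) → Elt B → ℕ → Build

  Elt : Build → Set
  Elt (base m)    = Fin (suc m)
  Elt (adj B x m) = Elt B ⊎ Fin (suc m)

bot : (B : Build) → Elt B
bot (base m)    = F.zero
bot (adj B x m) = inj₁ (bot B)

-- The order of the adjunct construction L1 ]_a^b L2 with a = 0, b = x.
Le : (B : Build) → Elt B → Elt B → Set
Le (base m)    i        j        = toℕ i ≤ toℕ j
Le (adj B x m) (inj₁ u) (inj₁ v) = Le B u v
Le (adj B x m) (inj₂ u) (inj₂ v) = toℕ u ≤ toℕ v
Le (adj B x m) (inj₁ u) (inj₂ v) = Le B u (bot B)
Le (adj B x m) (inj₂ u) (inj₁ v) = Le B x v

Lt : (B : Build) → Elt B → Elt B → Set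
Lt B u v = Le B u v × ¬ (u ≡ v)

Covers : (B : Build) → Elt B → Elt B → Set
Covers B a b = Lt B a b × (∀ z → Lt B a z → Lt B z b → ⊥)

-- Validity of each adjunction step: (0, x) is an adjunct pair, i.e.
-- 0 < x and x does not cover 0 in the lattice built so far.
Valid : Build → Set
Valid (base m)    = ⊤
Valid (adj B x m) = Valid B × Lt B (bot B) x × ¬ Covers B (bot B) x

depth : Build → ℕ
depth (base m)    = 0
depth (adj B x m) = suc (depth B)

chainIdx : (B : Build) → Elt B → ℕ
chainIdx (base m)    _        = 0
chainIdx (adj B x m) (inj₁ u) = chainIdx B u
chainIdx (adj B x m) (inj₂ _) = suc (depth B)

-- the element x_i of L (meaningful for 1 ≤ i ≤ depth B; 0 otherwise)
xpt : (B : Build) → ℕ → Elt B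
xpt (base m)    i = F.zero
xpt (adj B x m) i with i ≟ suc (depth B)
... | yes _ = inj₁ x
... | no  _ = inj₁ (xpt B i)

IsMeet : (B : Build) → Elt B → Elt B → Elt B → Set
IsMeet B a b m = Le B m a × Le B m b × (∀ z → Le B z a → Le B z b → Le B z m)

Incomparable : (B : Build) → Elt B → Elt B → Set
Incomparable B a b = ¬ Le B a b × ¬ Le B b a

IsVertex : (B : Build) → Elt B → Set
IsVertex B v = ¬ (v ≡ bot B) × ∃ λ y → ¬ (y ≡ bot B) × IsMeet B v y (bot B)

HasSize : (A : Set) → (A → Set) → ℕ → Set
HasSize A P k = Σ (Fin k → A) λ f →
  Injective _≡_ _≡_ f × (∀ i → P (f i)) × (∀ a → P a → ∃ λ i → f i ≡ a)

module Submission where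

-- An element of a newly adjoined chain C_i lies above exactly those elements above x_i,
-- and the only element of the earlier lattice below it is 0; by induction on the
-- construction, any two elements with a common nonzero lower bound are comparable,
-- which gives (i), and (ii) is read off the order of the last adjunction. For (iii), if
-- x_i = 1 then 1 meets nothing to 0, while every a ∉ {0, 1} is incomparable to a nonzero
-- element: to a nonzero element of C_i or to a nonzero non-top element of C_0, which
-- exists because the first adjunct pair (0, x_1) is not a covering pair of C_0.

open import Defs
open import Data.Nat using (ℕ; _≤_; _∸_; zero; suc; z≤n; s≤s; _≟_)
open import Data.Nat.Properties
  using (≤-refl; ≤-trans; ≤-total; ≤-antisym; _≤?_; n≤0⇒n≡0; m≤n⇒m≤1+n; 1+n≰n;
         ≤∧≢⇒<; m<1+n⇒m≤n; ∸-+-assoc)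
open import Data.Product using (_×_; ∃; _,_; proj₁; proj₂)
open import Data.Sum using (_⊎_; inj₁; inj₂)
open import Data.Sum.Properties using (inj₁-injective)
import Data.Sum.Properties as Sum
open import Data.Unit using (⊤; tt)
open import Data.Empty using (⊥; ⊥-elim)
open import Data.Fin using (Fin; toℕ; punchIn; punchOut)
import Data.Fin as F
import Data.Fin.Properties as Fin
open import Relation.Nullary using (¬_; yes; no; Dec)
open import Relation.Binary.PropositionalEquality using (_≡_; _≢_; refl; sym; trans; cong; subst)
open import Relation.Binary.Definitions using (DecidableEquality)
open import Function.Bundles using (_⇔_; mk⇔; Equivalence)

m≤1+n∧m≢1+n⇒m≤n : ∀ {m n} → m ≤ suc n → m ≢ suc n → m ≤ n
m≤1+n∧m≢1+n⇒m≤n m≤1+n m≢1+n = m<1+n⇒m≤n (≤∧≢⇒< m≤1+n m≢1+n)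

inj₁-≢ : ∀ {A C : Set} {u v : A} → inj₁ {B = C} u ≢ inj₁ v → u ≢ v
inj₁-≢ ne u≡v = ne (cong inj₁ u≡v)

≢-inj₁ : ∀ {A C : Set} {u v : A} → u ≢ v → inj₁ {B = C} u ≢ inj₁ v
≢-inj₁ ne e = ne (inj₁-injective e)

bot-least : (B : Build) → ∀ z → Le B (bot B) z
bot-least (base m)    z        = z≤n
bot-least (adj B x m) (inj₁ v) = bot-least B v
bot-least (adj B x m) (inj₂ v) = bot-least B (bot B)

Le-refl : (B : Build) → ∀ z → Le B z z
Le-refl (base m)    z        = ≤-refl
Le-refl (adj B x m) (inj₁ v) = Le-refl B v
Le-refl (adj B x m) (inj₂ v) = ≤-refl

Le-bot⇒≡bot : (B : Build) → Valid B → ∀ z → Le B z (bot B) → z ≡ bot B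
Le-bot⇒≡bot (base m)    _                 z        z≤0 = Fin.toℕ-injective (n≤0⇒n≡0 z≤0)
Le-bot⇒≡bot (adj B x m) (valid , _ , _)   (inj₁ u) u≤0 = cong inj₁ (Le-bot⇒≡bot B valid u u≤0)
Le-bot⇒≡bot (adj B x m) (valid , 0<x , _) (inj₂ u) x≤0 =
  ⊥-elim (proj₂ 0<x (sym (Le-bot⇒≡bot B valid x x≤0)))

Le-trans : (B : Build) → Valid B → ∀ a b c → Le B a b → Le B b c → Le B a c
Le-trans (base m) _ a b c p q = ≤-trans p q
Le-trans (adj B x m) (valid , 0<x , _) = go
  where
  go : ∀ a b c → Le (adj B x m) a b → Le (adj B x m) b c → Le (adj B x m) a c
  go (inj₁ a) (inj₁ b) (inj₁ c) p q = Le-trans B valid a b c p q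
  go (inj₁ a) (inj₁ b) (inj₂ c) p q = Le-trans B valid a b (bot B) p q
  go (inj₁ a) (inj₂ b) (inj₁ c) p q = subst (λ w → Le B w c) (sym (Le-bot⇒≡bot B valid a p)) (bot-least B c)
  go (inj₁ a) (inj₂ b) (inj₂ c) p q = p
  go (inj₂ a) (inj₁ b) (inj₁ c) p q = Le-trans B valid x b c p q
  go (inj₂ a) (inj₁ b) (inj₂ c) p q = ⊥-elim (proj₂ 0<x (sym (Le-bot⇒≡bot B valid x (Le-trans B valid x b (bot B) p q))))
  go (inj₂ a) (inj₂ b) (inj₁ c) p q = q
  go (inj₂ a) (inj₂ b) (inj₂ c) p q = ≤-trans p q

Le-antisym : (B : Build) → Valid B → ∀ a b → Le B a b → Le B b a → a ≡ b
Le-antisym (base m) _ a b p q = Fin.toℕ-injective (≤-antisym p q)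
Le-antisym (adj B x m) (valid , 0<x , _) = go
  where
  x≰0 : ¬ Le B x (bot B)
  x≰0 x≤0 = proj₂ 0<x (sym (Le-bot⇒≡bot B valid x x≤0))

  go : ∀ a b → Le (adj B x m) a b → Le (adj B x m) b a → a ≡ b
  go (inj₁ a) (inj₁ b) p q = cong inj₁ (Le-antisym B valid a b p q)
  go (inj₁ a) (inj₂ b) p q = ⊥-elim (x≰0 (subst (Le B x) (Le-bot⇒≡bot B valid a p) q))
  go (inj₂ a) (inj₁ b) p q = ⊥-elim (x≰0 (subst (Le B x) (Le-bot⇒≡bot B valid b q) p))
  go (inj₂ a) (inj₂ b) p q = cong inj₂ (Fin.toℕ-injective (≤-antisym p q))

Elt-≟ : (B : Build) → DecidableEquality (Elt B)
Elt-≟ (base m)    = Fin._≟_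
Elt-≟ (adj B x m) = Sum.≡-dec (Elt-≟ B) Fin._≟_

Le? : (B : Build) → ∀ a b → Dec (Le B a b)
Le? (base m)    a        b        = toℕ a ≤? toℕ b
Le? (adj B x m) (inj₁ a) (inj₁ b) = Le? B a b
Le? (adj B x m) (inj₁ a) (inj₂ b) = Le? B a (bot B)
Le? (adj B x m) (inj₂ a) (inj₁ b) = Le? B x b
Le? (adj B x m) (inj₂ a) (inj₂ b) = toℕ a ≤? toℕ b

common-nonzero-lower-bound⇒comparable : (B : Build) → Valid B → ∀ a b z →
  z ≢ bot B → Le B z a → Le B z b → Le B a b ⊎ Le B b a
common-nonzero-lower-bound⇒comparable (base m) _ a b _ _ _ _ = ≤-total (toℕ a) (toℕ b)
common-nonzero-lower-bound⇒comparable (adj B x m) (valid , 0<x , _) = go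
  where
  go : ∀ a b z → z ≢ bot (adj B x m) → Le (adj B x m) z a → Le (adj B x m) z b →
       Le (adj B x m) a b ⊎ Le (adj B x m) b a
  go (inj₁ a) (inj₁ b) (inj₁ z) z≢0 p q =
    common-nonzero-lower-bound⇒comparable B valid a b z (inj₁-≢ z≢0) p q
  go (inj₂ a) b        (inj₁ z) z≢0 p q = ⊥-elim (z≢0 (cong inj₁ (Le-bot⇒≡bot B valid z p)))
  go (inj₁ a) (inj₂ b) (inj₁ z) z≢0 p q = ⊥-elim (z≢0 (cong inj₁ (Le-bot⇒≡bot B valid z q)))
  go (inj₁ a) (inj₁ b) (inj₂ z) z≢0 p q =
    common-nonzero-lower-bound⇒comparable B valid a b x (λ e → proj₂ 0<x (sym e)) p q
  go (inj₁ a) (inj₂ b) (inj₂ z) z≢0 p q = inj₂ p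
  go (inj₂ a) (inj₁ b) (inj₂ z) z≢0 p q = inj₁ q
  go (inj₂ a) (inj₂ b) (inj₂ z) z≢0 p q = ≤-total (toℕ a) (toℕ b)

meet≡bot⇔incomparable : (B : Build) → Valid B → (a b : Elt B) → a ≢ bot B → b ≢ bot B →
  IsMeet B a b (bot B) ⇔ Incomparable B a b
meet≡bot⇔incomparable B valid a b a≢0 b≢0 = mk⇔ to from
  where
  to : IsMeet B a b (bot B) → Incomparable B a b
  to (_ , _ , greatest) =
      (λ a≤b → a≢0 (Le-bot⇒≡bot B valid a (greatest a (Le-refl B a) a≤b)))
    , (λ b≤a → b≢0 (Le-bot⇒≡bot B valid b (greatest b b≤a (Le-refl B b))))

  from : Incomparable B a b → IsMeet B a b (bot B)
  from (a≰b , b≰a) = bot-least B a , bot-least B b , greatest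
    where
    greatest : ∀ z → Le B z a → Le B z b → Le B z (bot B)
    greatest z z≤a z≤b with Elt-≟ B z (bot B)
    ... | yes refl = Le-refl B (bot B)
    ... | no z≢0 with common-nonzero-lower-bound⇒comparable B valid a b z z≢0 z≤a z≤b
    ...   | inj₁ a≤b = ⊥-elim (a≰b a≤b)
    ...   | inj₂ b≤a = ⊥-elim (b≰a b≤a)

chainIdx≤depth : (B : Build) → ∀ a → chainIdx B a ≤ depth B
chainIdx≤depth (base m)    a        = z≤n
chainIdx≤depth (adj B x m) (inj₁ a) = m≤n⇒m≤1+n (chainIdx≤depth B a)
chainIdx≤depth (adj B x m) (inj₂ a) = ≤-refl

chainIdx≡0-upward : (B : Build) → Valid B → ∀ a b →
  chainIdx B a ≡ 0 → a ≢ bot B → Le B a b → chainIdx B b ≡ 0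
chainIdx≡0-upward (base m)    _           a        b        _  _   _ = refl
chainIdx≡0-upward (adj B x m) (valid , _) (inj₁ a) (inj₁ b) a₀ a≢0 p =
  chainIdx≡0-upward B valid a b a₀ (inj₁-≢ a≢0) p
chainIdx≡0-upward (adj B x m) (valid , _) (inj₁ a) (inj₂ b) a₀ a≢0 p =
  ⊥-elim (a≢0 (cong inj₁ (Le-bot⇒≡bot B valid a p)))
chainIdx≡0-upward (adj B x m) _           (inj₂ a) b        () _ _

xpt≢bot : (B : Build) → Valid B → (i : ℕ) → 1 ≤ i → i ≤ depth B → xpt B i ≢ bot B
xpt≢bot (base m) _ (suc i) _ ()
xpt≢bot (adj B x m) (valid , 0<x , _) i 1≤i i≤n with i ≟ suc (depth B)
... | yes _   = ≢-inj₁ (λ e → proj₂ 0<x (sym e))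
... | no  i≢n = ≢-inj₁ (xpt≢bot B valid i 1≤i (m≤1+n∧m≢1+n⇒m≤n i≤n i≢n))

Le⇔xpt-Le : (B : Build) → Valid B → (i : ℕ) → 1 ≤ i → i ≤ depth B → (a b : Elt B) →
  a ≢ bot B → b ≢ bot B → chainIdx B a ≡ i → chainIdx B b ≢ i →
  Le B a b ⇔ Le B (xpt B i) b
Le⇔xpt-Le (base m) _ (suc i) _ ()
Le⇔xpt-Le (adj B x m) (valid , _) i 1≤i i≤n a b a≢0 b≢0 a∈Cᵢ b∉Cᵢ with i ≟ suc (depth B)
Le⇔xpt-Le (adj B x m) _ i _ _ (inj₁ a) b _ _ refl _ | yes i≡n =
  ⊥-elim (1+n≰n (subst (_≤ depth B) i≡n (chainIdx≤depth B a)))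
Le⇔xpt-Le (adj B x m) _ i _ _ (inj₂ a) (inj₁ b) _ _ _ _ | yes _ = mk⇔ (λ p → p) (λ p → p)
Le⇔xpt-Le (adj B x m) _ i _ _ (inj₂ a) (inj₂ b) _ _ a∈Cᵢ b∉Cᵢ | yes _ = ⊥-elim (b∉Cᵢ a∈Cᵢ)
Le⇔xpt-Le (adj B x m) _ i _ _ (inj₂ a) b _ _ refl _ | no i≢n = ⊥-elim (i≢n refl)
Le⇔xpt-Le (adj B x m) (valid , _) i 1≤i i≤n (inj₁ a) (inj₁ b) a≢0 b≢0 a∈Cᵢ b∉Cᵢ | no i≢n =
  Le⇔xpt-Le B valid i 1≤i (m≤1+n∧m≢1+n⇒m≤n i≤n i≢n) a b (inj₁-≢ a≢0) (inj₁-≢ b≢0) a∈Cᵢ b∉Cᵢ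
Le⇔xpt-Le (adj B x m) (valid , _) i 1≤i i≤n (inj₁ a) (inj₂ b) a≢0 _ _ _ | no i≢n = mk⇔
  (λ a≤0 → ⊥-elim (a≢0 (cong inj₁ (Le-bot⇒≡bot B valid a a≤0))))
  (λ xᵢ≤0 → ⊥-elim (xpt≢bot B valid i 1≤i (m≤1+n∧m≢1+n⇒m≤n i≤n i≢n) (Le-bot⇒≡bot B valid _ xᵢ≤0)))

HasSize-remove : ∀ {A : Set} → DecidableEquality A → {P : A → Set} → ∀ k → HasSize A P k →
  (p : A) → P p → HasSize A (λ a → P a × a ≢ p) (k ∸ 1)
HasSize-remove _ zero (f , _ , _ , onto) p Pp with onto p Pp
... | () , _
HasSize-remove {A} _ {P} (suc k) (f , f-inj , f-in , onto) p Pp with onto p Pp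
... | j , fj≡p = g , g-inj , g-in , g-onto
  where
  g : Fin k → A
  g i = f (punchIn j i)

  g-inj : ∀ {i i′} → g i ≡ g i′ → i ≡ i′
  g-inj e = Fin.punchIn-injective j _ _ (f-inj e)

  g-in : ∀ i → P (g i) × g i ≢ p
  g-in i = f-in (punchIn j i) , λ e → Fin.punchInᵢ≢i j i (f-inj (trans e (sym fj≡p)))

  g-onto : ∀ a → P a × a ≢ p → ∃ λ i → g i ≡ a
  g-onto a (Pa , a≢p) with onto a Pa
  ... | i , fi≡a with i Fin.≟ j
  ...   | yes refl = ⊥-elim (a≢p (trans (sym fi≡a) fj≡p))
  ...   | no  i≢j  = punchOut j≢i , trans (cong f (Fin.punchIn-punchOut j≢i)) fi≡a
    where
    j≢i : j ≢ i
    j≢i e = i≢j (sym e)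

HasSize-cong : ∀ {A : Set} {P Q : A → Set} {k} →
  (∀ a → P a → Q a) → (∀ a → Q a → P a) → HasSize A P k → HasSize A Q k
HasSize-cong P⇒Q Q⇒P (f , f-inj , f-in , onto) =
  f , f-inj , (λ i → P⇒Q _ (f-in i)) , (λ a Qa → onto a (Q⇒P a Qa))

nonzero-in-chain : (B : Build) → (i : ℕ) → 1 ≤ i → i ≤ depth B →
  ∃ λ c → chainIdx B c ≡ i × c ≢ bot B
nonzero-in-chain (base m) (suc i) _ ()
nonzero-in-chain (adj B x m) i 1≤i i≤n with i ≟ suc (depth B)
... | yes i≡n = inj₂ F.zero , sym i≡n , (λ ())
... | no  i≢n with nonzero-in-chain B i 1≤i (m≤1+n∧m≢1+n⇒m≤n i≤n i≢n)
...   | c , c∈Cᵢ , c≢0 = inj₁ c , c∈Cᵢ , ≢-inj₁ c≢0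

nonzero-nontop-in-chain₀ : (B : Build) → Valid B → 1 ≤ depth B →
  ∃ λ c → chainIdx B c ≡ 0 × c ≢ bot B × ∃ λ d → ¬ Le B d c
nonzero-nontop-in-chain₀ (base m) _ ()
nonzero-nontop-in-chain₀ (adj (base k) F.zero m) (_ , 0<x , _) _ = ⊥-elim (proj₂ 0<x refl)
nonzero-nontop-in-chain₀ (adj (base k) (F.suc F.zero) m) (_ , 0<x , ¬covers) _ = ⊥-elim (¬covers (0<x , between))
  where
  between : ∀ z → Lt (base k) F.zero z → Lt (base k) z (F.suc F.zero) → ⊥
  between F.zero             0<z _            = proj₂ 0<z refl
  between (F.suc F.zero)     _   z<1          = proj₂ z<1 refl
  between (F.suc (F.suc z)) _   (s≤s () , _)
nonzero-nontop-in-chain₀ (adj (base k) (F.suc (F.suc y)) m) _ _ =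
  inj₁ (F.suc F.zero) , refl , (λ ()) , inj₁ (F.suc (F.suc y)) , λ { (s≤s ()) }
nonzero-nontop-in-chain₀ (adj (adj B x′ m′) x m) (valid , _) _
  with nonzero-nontop-in-chain₀ (adj B x′ m′) valid (s≤s z≤n)
... | c , c∈C₀ , c≢0 , d , d≰c = inj₁ c , c∈C₀ , ≢-inj₁ c≢0 , inj₁ d , d≰c

module _ (B : Build) (valid : Valid B) (i : ℕ) (1≤i : 1 ≤ i) (i≤n : i ≤ depth B)
         (top : ∀ z → Le B z (xpt B i)) where

  private
    T = xpt B i

    incomparable⇒vertex : ∀ a y → a ≢ bot B → y ≢ bot B → Incomparable B a y → IsVertex B a
    incomparable⇒vertex a y a≢0 y≢0 a∥y =
      a≢0 , y , y≢0 , Equivalence.from (meet≡bot⇔incomparable B valid a y a≢0 y≢0) a∥y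

    i≢0 : i ≢ 0
    i≢0 i≡0 = 1+n≰n (subst (1 ≤_) i≡0 1≤i)

  vertex⇒≢top : ∀ a → IsVertex B a → a ≢ T
  vertex⇒≢top a (_ , y , y≢0 , (_ , _ , greatest)) refl =
    y≢0 (Le-bot⇒≡bot B valid y (greatest y (top y) (Le-refl B y)))

  nonzero-nontop⇒vertex : ∀ a → a ≢ bot B → a ≢ T → IsVertex B a
  nonzero-nontop⇒vertex a a≢0 a≢T with nonzero-in-chain B i 1≤i i≤n
                                    | nonzero-nontop-in-chain₀ B valid (≤-trans 1≤i i≤n)
  ... | cᵢ , cᵢ∈Cᵢ , cᵢ≢0 | c , c∈C₀ , c≢0 , d , d≰c = by-chain (chainIdx B a ≟ i)
    where
    T≰c : ¬ Le B T c
    T≰c T≤c = d≰c (Le-trans B valid d T c (top d) T≤c)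

    c∉Cᵢ : chainIdx B c ≢ i
    c∉Cᵢ c∈Cᵢ = i≢0 (trans (sym c∈Cᵢ) c∈C₀)

    cᵢ∉C₀ : chainIdx B cᵢ ≢ 0
    cᵢ∉C₀ cᵢ∈C₀ = i≢0 (trans (sym cᵢ∈Cᵢ) cᵢ∈C₀)

    c≤⇒∈C₀ : ∀ z → Le B c z → chainIdx B z ≡ 0
    c≤⇒∈C₀ z = chainIdx≡0-upward B valid c z c∈C₀ c≢0

    by-chain : Dec (chainIdx B a ≡ i) → IsVertex B a
    by-chain (yes a∈Cᵢ) = incomparable⇒vertex a c a≢0 c≢0
      ( (λ a≤c → T≰c (Equivalence.to (Le⇔xpt-Le B valid i 1≤i i≤n a c a≢0 c≢0 a∈Cᵢ c∉Cᵢ) a≤c))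
      , (λ c≤a → i≢0 (trans (sym a∈Cᵢ) (c≤⇒∈C₀ a c≤a))) )
    by-chain (no a∉Cᵢ) with Le? B a cᵢ
    ... | no a≰cᵢ = incomparable⇒vertex a cᵢ a≢0 cᵢ≢0
      ( a≰cᵢ
      , (λ cᵢ≤a → a≢T (Le-antisym B valid a T (top a)
          (Equivalence.to (Le⇔xpt-Le B valid i 1≤i i≤n cᵢ a cᵢ≢0 a≢0 cᵢ∈Cᵢ a∉Cᵢ) cᵢ≤a))) )
    ... | yes a≤cᵢ = incomparable⇒vertex a c a≢0 c≢0 (a≰c , c≰a)
      where
      c≰a : ¬ Le B c a
      c≰a c≤a = cᵢ∉C₀ (chainIdx≡0-upward B valid a cᵢ (c≤⇒∈C₀ a c≤a) a≢0 a≤cᵢ)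

      a≰c : ¬ Le B a c
      a≰c a≤c with common-nonzero-lower-bound⇒comparable B valid c cᵢ a a≢0 a≤c a≤cᵢ
      ... | inj₁ c≤cᵢ = cᵢ∉C₀ (c≤⇒∈C₀ cᵢ c≤cᵢ)
      ... | inj₂ cᵢ≤c = T≰c (Equivalence.to (Le⇔xpt-Le B valid i 1≤i i≤n cᵢ c cᵢ≢0 c≢0 cᵢ∈Cᵢ c∉Cᵢ) cᵢ≤c)

  vertices-size : (N : ℕ) → HasSize (Elt B) (λ _ → ⊤) N → HasSize (Elt B) (IsVertex B) (N ∸ 2)
  vertices-size N all =
    subst (HasSize (Elt B) (IsVertex B)) (∸-+-assoc N 1 1)
      (HasSize-cong
        (λ a ((_ , a≢0) , a≢T) → nonzero-nontop⇒vertex a a≢0 a≢T)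
        (λ a v → (tt , proj₁ v) , vertex⇒≢top a v)
        (HasSize-remove (Elt-≟ B) (N ∸ 1) (HasSize-remove (Elt-≟ B) N all (bot B) tt)
          T (tt , xpt≢bot B valid i 1≤i i≤n)))

lemma2p10 : (B : Build) → Valid B →
    ((a b : Elt B) → ¬ (a ≡ bot B) → ¬ (b ≡ bot B) →
       (IsMeet B a b (bot B) ⇔ Incomparable B a b))
    × ((i : ℕ) → 1 ≤ i → i ≤ depth B → (a b : Elt B) →
       ¬ (a ≡ bot B) → ¬ (b ≡ bot B) →
       chainIdx B a ≡ i → ¬ (chainIdx B b ≡ i) →
       (Le B a b ⇔ Le B (xpt B i) b))
    × ((∃ λ i → 1 ≤ i × i ≤ depth B × (∀ z → Le B z (xpt B i))) →
       (N : ℕ) → HasSize (Elt B) (λ _ → ⊤) N →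
       HasSize (Elt B) (IsVertex B) (N ∸ 2))
lemma2p10 B valid =
    meet≡bot⇔incomparable B valid
  , Le⇔xpt-Le B valid
  , λ (i , 1≤i , i≤n , top) → vertices-size B valid i 1≤i i≤n top
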